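{- Let $(F,i)$ be a filter pair over a signature $\Sigma$ and $(F',i')$ a filter pair over a signature $\Sigma'$, and let $(H,j):(F,i)\to(F',i')$ be a morphism of filter pairs. Then $(H,\mathrm{Id},j):I_{(F',i')}\to I_{(F,i)}$ is an institution morphism, where $\mathrm{Id}$ denotes the identity natural transformation $\mathit{Sen}_{(F,i)}\circ H\Rightarrow\mathit{Sen}_{(F',i')}$ (both functors send $M'$ to the underlying set $|M'|=|H(M')|$).
   Context: A signature $\Sigma=(\Sigma_n)_{n\in\mathbb N}$ is a family of sets of $n$-ary operation symbols; $\Sigma\text{ -str}$ is the category of $\Sigma$-algebras and homomorphisms. A filter pair over $\Sigma$ is a pair $(F,i)$ with $F:(\Sigma\text{ -str})^{op}\to\mathbf{CLat}$ a contravariant functor into complete lattices and $i=(i_M:F(M)\to(\mathcal P(|M|),\subseteq))_M$ a natural transformation ($i_M\circ F(f)=f^{ -1}\circ i_N$ for $f:M\to N$). A morphism of filter pairs $(F,i)\to(F',i')$ is a pair $(H,j)$ where $H:\Sigma'\text{ -str}\to\Sigma\text{ -str}$ is a signature functor (a functor commuting with the forgetful functors to $\mathbf{Set}$, i.e. preserving underlying sets and maps) and $j:F'\Rightarrow F\circ H$ is a natural transformation such that $i_{H(M')}\circ j_{M'}=i'_{M'}$ for every $M'\in\Sigma'\text{ -str}$. For a filter pair $(F,i)$ over $\Sigma$, $I_{(F,i)}$ is the institution with signature category $\Sigma\text{ -str}$, sentence functor the forgetful functor $\Sigma\text{ -str}\to\mathbf{Set}$, model functor $F$ (complete lattices viewed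 as poset categories), and satisfaction $t\models_M m$ iff $m\in i_M(t)$, for $t\in F(M)$, $m\in|M|$. An institution morphism $\langle\Phi,\alpha,\beta\rangle:I\to I'$ consists of a functor $\Phi:\mathit{Sig}\to\mathit{Sig}'$ and natural transformations $\alpha:\mathit{Sen}'\circ\Phi\Rightarrow\mathit{Sen}$ and $\beta:\mathit{Mod}\Rightarrow\mathit{Mod}'\circ\Phi^{op}$ such that $m\models_\Sigma\alpha_\Sigma(\varphi')$ iff $\beta_\Sigma(m)\models'_{\Phi(\Sigma)}\varphi'$ for all $\Sigma$, models $m$ of $\Sigma$ and $\varphi'\in\mathit{Sen}'(\Phi\Sigma)$. -}

module Defs where

open import Level using (Level; 0ℓ) renaming (suc to lsuc)
open import Data.Nat using (ℕ)
open import Data.Fin using (Fin)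
open import Data.Product using (Σ; ∃; _×_; _,_; proj₁; proj₂)
open import Function using (_∘_; id)
open import Function.Bundles using (_⇔_; mk⇔)
open import Relation.Unary using (Pred; _⊆_; _≐_)
open import Relation.Binary using (Poset; Rel; IsEquivalence)
open import Relation.Binary.PropositionalEquality
  using (_≡_; refl; sym; trans; cong; _≗_)

record Category (o h e : Level) : Set (lsuc (o Level.⊔ h Level.⊔ e)) where
  infix  4 _≈_
  infixr 9 _∘C_
  field
    Obj   : Set o
    _⇒_   : Obj → Obj → Set h
    _≈_   : ∀ {A B} → Rel (A ⇒ B) e
    ≈-equiv : ∀ {A B} → IsEquivalence (_≈_ {A} {B})
    idC   : ∀ {A} → A ⇒ A
    _∘C_  : ∀ {A B C} → B ⇒ C → A ⇒ B → A ⇒ C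
    ∘-resp : ∀ {A B C} {f f' : B ⇒ C} {g g' : A ⇒ B} →
             f ≈ f' → g ≈ g' → f ∘C g ≈ f' ∘C g'
    identityˡ : ∀ {A B} {f : A ⇒ B} → idC ∘C f ≈ f
    identityʳ : ∀ {A B} {f : A ⇒ B} → f ∘C idC ≈ f
    assoc : ∀ {A B C D} {f : A ⇒ B} {g : B ⇒ C} {h : C ⇒ D} →
            (h ∘C g) ∘C f ≈ h ∘C (g ∘C f)

record Functor {o h e o' h' e'} (C : Category o h e) (D : Category o' h' e')
       : Set (o Level.⊔ h Level.⊔ e Level.⊔ o' Level.⊔ h' Level.⊔ e') where
  private
    module C = Category C
    module D = Category D
  field
    F₀ : C.Obj → D.Obj
    F₁ : ∀ {A B} → A C.⇒ B → F₀ A D.⇒ F₀ B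
    F-resp : ∀ {A B} {f g : A C.⇒ B} → f C.≈ g → F₁ f D.≈ F₁ g
    F-id : ∀ {A} → F₁ (C.idC {A}) D.≈ D.idC
    F-∘ : ∀ {A B C'} {f : A C.⇒ B} {g : B C.⇒ C'} →
          F₁ (g C.∘C f) D.≈ F₁ g D.∘C F₁ f

record Signature : Set₁ where
  field Op : ℕ → Set
open Signature public

record Alg (S : Signature) : Set₁ where
  field
    Carrier : Set
    ⟦_⟧ : ∀ {n} → Op S n → (Fin n → Carrier) → Carrier
open Alg public renaming (Carrier to ∣_∣)

IsHom : ∀ {S} (M N : Alg S) → (∣ M ∣ → ∣ N ∣) → Set
IsHom {S} M N f = ∀ {n} (σ : Op S n) (xs : Fin n → ∣ M ∣) →
                  f (⟦ M ⟧ σ xs) ≡ ⟦ N ⟧ σ (f ∘ xs)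

record Hom {S} (M N : Alg S) : Set where
  constructor mkHom
  field
    fun : ∣ M ∣ → ∣ N ∣
    isHom : IsHom M N fun
open Hom public

idHom : ∀ {S} (M : Alg S) → Hom M M
idHom M = mkHom id (λ σ xs → refl)

_∘H_ : ∀ {S} {M N P : Alg S} → Hom N P → Hom M N → Hom M P
_∘H_ {P = P} g f = mkHom (fun g ∘ fun f)
  (λ σ xs → trans (cong (fun g) (isHom f σ xs)) (isHom g σ (fun f ∘ xs)))

StrCat : Signature → Category (lsuc 0ℓ) 0ℓ 0ℓ
StrCat S = record
  { Obj = Alg S
  ; _⇒_ = Hom
  ; _≈_ = λ f g → fun f ≗ fun g
  ; ≈-equiv = record { refl = λ _ → refl ; sym = λ p x → sym (p x)
                     ; trans = λ p q x → trans (p x) (q x) }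
  ; idC = idHom _
  ; _∘C_ = _∘H_
  ; ∘-resp = λ {_} {_} {_} {f} {f'} {g} {g'} p q x →
               trans (cong (fun f) (q x)) (p (fun g' x))
  ; identityˡ = λ _ → refl
  ; identityʳ = λ _ → refl
  ; assoc = λ _ → refl
  }

-- Signature functors H : Σ'-str → Σ-str, i.e. functors commuting (strictly)
-- with the forgetful functors to Set: H(M') has the same carrier as M'
-- (with some Σ-operations on it), and H(f) has the same underlying map as f.

record SigFunctor (S' S : Signature) : Set₁ where
  field
    ops : (M : Alg S') → ∀ {n} → Op S n → (Fin n → ∣ M ∣) → ∣ M ∣
  obj : Alg S' → Alg S
  obj M = record { Carrier = ∣ M ∣ ; ⟦_⟧ = ops M }
  field
    hom-pres : ∀ {M N : Alg S'} (f : Hom M N) → IsHom (obj M) (obj N) (fun f)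
  hom : ∀ {M N : Alg S'} → Hom M N → Hom (obj M) (obj N)
  hom f = mkHom (fun f) (hom-pres f)

SigFunctor→Functor : ∀ {S' S} → SigFunctor S' S → Functor (StrCat S') (StrCat S)
SigFunctor→Functor H = record
  { F₀ = SigFunctor.obj H
  ; F₁ = SigFunctor.hom H
  ; F-resp = λ p → p
  ; F-id = λ _ → refl
  ; F-∘ = λ _ → refl
  }

module OrderNotions (P : Poset 0ℓ 0ℓ 0ℓ) where
  open Poset P using (_≤_) renaming (Carrier to ∣P∣)
  IsLB : Pred ∣P∣ 0ℓ → ∣P∣ → Set
  IsLB X x = ∀ y → X y → x ≤ y
  IsUB : Pred ∣P∣ 0ℓ → ∣P∣ → Set
  IsUB X x = ∀ y → X y → y ≤ x
  IsInf : Pred ∣P∣ 0ℓ → ∣P∣ → Set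
  IsInf X x = IsLB X x × (∀ z → IsLB X z → z ≤ x)
  IsSup : Pred ∣P∣ 0ℓ → ∣P∣ → Set
  IsSup X x = IsUB X x × (∀ z → IsUB X z → x ≤ z)
  Directed : Pred ∣P∣ 0ℓ → Set
  Directed X = (∃ λ x → X x) ×
               (∀ x y → X x → X y → ∃ λ z → X z × x ≤ z × y ≤ z)

record CLat : Set₁ where
  field poset : Poset 0ℓ 0ℓ 0ℓ
  open Poset poset public
  open OrderNotions poset public
  field
    ⋀ : Pred Carrier 0ℓ → Carrier
    ⋀-isInf : ∀ X → IsInf X (⋀ X)

record CLatMor (L K : CLat) : Set₁ where
  private
    module L = CLat L
    module K = CLat K
  field
    _⟨$⟩_ : L.Carrier → K.Carrier
  image : Pred L.Carrier 0ℓ → Pred K.Carrier 0ℓ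
  image X y = ∃ λ x → X x × (y K.≈ _⟨$⟩_ x)
  field
    cong≈ : ∀ {x y} → x L.≈ y → _⟨$⟩_ x K.≈ _⟨$⟩_ y
    mono : ∀ {x y} → x L.≤ y → _⟨$⟩_ x K.≤ _⟨$⟩_ y   -- (implied by ⋀-pres)
    ⋀-pres : ∀ X x → L.IsInf X x → K.IsInf (image X) (_⟨$⟩_ x)
    ⋁-pres : ∀ X x → L.Directed X → L.IsSup X x → K.IsSup (image X) (_⟨$⟩_ x)
open CLatMor public

record FilterPair (S : Signature) : Set₁ where
  field
    F  : Alg S → CLat
    F₁ : ∀ {M N : Alg S} → Hom M N → CLatMor (F N) (F M)
  private module F (M : Alg S) = CLat (F M)
  field
    F-resp : ∀ {M N} {f g : Hom M N} → fun f ≗ fun g →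
             ∀ t → F._≈_ M (F₁ f ⟨$⟩ t) (F₁ g ⟨$⟩ t)
    F-id : ∀ {M} t → F._≈_ M (F₁ (idHom M) ⟨$⟩ t) t
    F-∘ : ∀ {M N P} (f : Hom M N) (g : Hom N P) t →
          F._≈_ M (F₁ (g ∘H f) ⟨$⟩ t) (F₁ f ⟨$⟩ (F₁ g ⟨$⟩ t))
    -- i_M : F(M) → (P(|M|), ⊆), a CLat-morphism into the powerset lattice
    i : (M : Alg S) → F.Carrier M → Pred (∣ M ∣) 0ℓ
    i-cong : ∀ {M} {t u} → F._≈_ M t u → i M t ≐ i M u
    i-mono : ∀ {M} {t u} → F._≤_ M t u → i M t ⊆ i M u
    i-⋀ : ∀ {M} X x → F.IsInf M X x → i M x ≐ (λ a → ∀ t → X t → i M t a)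
    i-⋁ : ∀ {M} X x → F.Directed M X → F.IsSup M X x →
          i M x ≐ (λ a → ∃ λ t → X t × i M t a)
    i-nat : ∀ {M N} (f : Hom M N) t → i M (F₁ f ⟨$⟩ t) ≐ (i N t ∘ fun f)

record FilterPairMor {S S'} (Fi : FilterPair S) (Fi' : FilterPair S') : Set₁ where
  private
    module Fi = FilterPair Fi
    module Fi' = FilterPair Fi'
  field
    H : SigFunctor S' S
  open SigFunctor H
  field
    j : (M' : Alg S') → CLatMor (Fi'.F M') (Fi.F (obj M'))
    j-nat : ∀ {M' N'} (f : Hom M' N') t →
            CLat._≈_ (Fi.F (obj M'))
              (Fi.F₁ (hom f) ⟨$⟩ (j N' ⟨$⟩ t)) (j M' ⟨$⟩ (Fi'.F₁ f ⟨$⟩ t))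
    j-i : ∀ (M' : Alg S') t → Fi.i (obj M') (j M' ⟨$⟩ t) ≐ Fi'.i M' t

-- Institutions (model categories are posets, viewed as thin categories)

record Institution : Set₂ where
  field
    Sig : Category (lsuc 0ℓ) 0ℓ 0ℓ
  open Category Sig
  field
    Sen : Obj → Set
    Sen₁ : ∀ {A B} → A ⇒ B → Sen A → Sen B
    Sen-resp : ∀ {A B} {f g : A ⇒ B} → f ≈ g → Sen₁ f ≗ Sen₁ g
    Sen-id : ∀ {A} → Sen₁ (idC {A}) ≗ id
    Sen-∘ : ∀ {A B C} (f : A ⇒ B) (g : B ⇒ C) → Sen₁ (g ∘C f) ≗ Sen₁ g ∘ Sen₁ f
    Mod : Obj → Poset 0ℓ 0ℓ 0ℓ
    Mod₁ : ∀ {A B} → A ⇒ B → Poset.Carrier (Mod B) → Poset.Carrier (Mod A)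
    Mod₁-mono : ∀ {A B} (f : A ⇒ B) {m n} → Poset._≤_ (Mod B) m n →
                Poset._≤_ (Mod A) (Mod₁ f m) (Mod₁ f n)
    Mod-resp : ∀ {A B} {f g : A ⇒ B} → f ≈ g → ∀ m →
               Poset._≈_ (Mod A) (Mod₁ f m) (Mod₁ g m)
    Mod-id : ∀ {A} m → Poset._≈_ (Mod A) (Mod₁ (idC {A}) m) m
    Mod-∘ : ∀ {A B C} (f : A ⇒ B) (g : B ⇒ C) m →
            Poset._≈_ (Mod A) (Mod₁ (g ∘C f) m) (Mod₁ f (Mod₁ g m))
    Sat : ∀ A → Poset.Carrier (Mod A) → Sen A → Set
    satisfaction : ∀ {A B} (f : A ⇒ B) (m : Poset.Carrier (Mod B)) (φ : Sen A) →
                   Sat A (Mod₁ f m) φ ⇔ Sat B m (Sen₁ f φ)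

record IsInstitutionMorphism (I I' : Institution)
    (Φ : Functor (Institution.Sig I) (Institution.Sig I'))
    (α : ∀ A → Institution.Sen I' (Functor.F₀ Φ A) → Institution.Sen I A)
    (β : ∀ A → Poset.Carrier (Institution.Mod I A) →
               Poset.Carrier (Institution.Mod I' (Functor.F₀ Φ A)))
    : Set₁ where
  private
    module I = Institution I
    module I' = Institution I'
    module Φ = Functor Φ
  open Category I.Sig
  field
    α-nat : ∀ {A B} (f : A ⇒ B) (φ' : I'.Sen (Φ.F₀ A)) →
            α B (I'.Sen₁ (Φ.F₁ f) φ') ≡ I.Sen₁ f (α A φ')
    β-mono : ∀ A {m n} → Poset._≤_ (I.Mod A) m n →
             Poset._≤_ (I'.Mod (Φ.F₀ A)) (β A m) (β A n)
    β-nat : ∀ {A B} (f : A ⇒ B) (m : Poset.Carrier (I.Mod B)) →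
            Poset._≈_ (I'.Mod (Φ.F₀ A)) (β A (I.Mod₁ f m)) (I'.Mod₁ (Φ.F₁ f) (β B m))
    sat : ∀ A (m : Poset.Carrier (I.Mod A)) (φ' : I'.Sen (Φ.F₀ A)) →
          I.Sat A m (α A φ') ⇔ I'.Sat (Φ.F₀ A) (β A m) φ'

Inst : ∀ {S} → FilterPair S → Institution
Inst {S} Fi = record
  { Sig = StrCat S
  ; Sen = ∣_∣
  ; Sen₁ = fun
  ; Sen-resp = λ p → p
  ; Sen-id = λ _ → refl
  ; Sen-∘ = λ _ _ _ → refl
  ; Mod = λ M → CLat.poset (F M)
  ; Mod₁ = λ f t → F₁ f ⟨$⟩ t
  ; Mod₁-mono = λ f → mono (F₁ f)
  ; Mod-resp = λ p → F-resp p
  ; Mod-id = F-id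
  ; Mod-∘ = F-∘
  ; Sat = λ M t m → i M t m
  ; satisfaction = λ f t m → mk⇔ (proj₁ (i-nat f t)) (proj₂ (i-nat f t))
  }
  where open FilterPair Fi

module Submission where

-- Each of the four conditions on an institution morphism is the image of one
-- piece of the data of (H,j):
--   * α = Id is natural because a signature functor H does not change
--     underlying maps, so Sen(H f) and Sen'(f) are literally the same map;
--   * each β_{M'} = j_{M'} is monotone, being a CLat-morphism;
--   * naturality of β is the naturality square of j, read backwards;
--   * the satisfaction condition  m ∈ i'_{M'}(t)  ⇔  m ∈ i_{H M'}(j_{M'} t)
--     is exactly the compatibility  i_{H(M')} ∘ j_{M'} = i'_{M'}.

open import Defs
open import Data.Product using (proj₁; proj₂)
open import Function.Bundles using (_⇔_; mk⇔)
open import Relation.Binary.PropositionalEquality using (_≡_; refl)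

module _ {S S'} {Fi : FilterPair S} {Fi' : FilterPair S'}
         (Hj : FilterPairMor Fi Fi') where

  open FilterPairMor Hj
  open SigFunctor H using (obj; hom)
  private
    module Fi = FilterPair Fi
    module Fi' = FilterPair Fi'

  sentence-translation-natural : ∀ {M' N'} (f : Hom M' N') (φ : ∣ M' ∣) →
    fun (hom f) φ ≡ fun f φ
  sentence-translation-natural f φ = refl

  model-translation-monotone : ∀ M' {t u} → CLat._≤_ (Fi'.F M') t u →
    CLat._≤_ (Fi.F (obj M')) (j M' ⟨$⟩ t) (j M' ⟨$⟩ u)
  model-translation-monotone M' = mono (j M')

  model-translation-natural : ∀ {M' N'} (f : Hom M' N') t →
    CLat._≈_ (Fi.F (obj M'))
      (j M' ⟨$⟩ (Fi'.F₁ f ⟨$⟩ t)) (Fi.F₁ (hom f) ⟨$⟩ (j N' ⟨$⟩ t))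
  model-translation-natural {M'} f t = CLat.Eq.sym (Fi.F (obj M')) (j-nat f t)

  satisfaction-preserved : ∀ M' t (m : ∣ M' ∣) →
    Fi'.i M' t m ⇔ Fi.i (obj M') (j M' ⟨$⟩ t) m
  satisfaction-preserved M' t m = mk⇔ (proj₂ (j-i M' t)) (proj₁ (j-i M' t))

proposition4p7 : ∀ {S S'} (Fi : FilterPair S) (Fi' : FilterPair S')
    (Hj : FilterPairMor Fi Fi') →
    IsInstitutionMorphism (Inst Fi') (Inst Fi)
      (SigFunctor→Functor (FilterPairMor.H Hj))
      (λ M' x → x)
      (λ M' t → FilterPairMor.j Hj M' ⟨$⟩ t)
proposition4p7 Fi Fi' Hj = record
  { α-nat  = sentence-translation-natural Hj
  ; β-mono = model-translation-monotone Hj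
  ; β-nat  = model-translation-natural Hj
  ; sat    = satisfaction-preserved Hj
  }
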